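{- There is a set $\Gamma$ of node expressions such that every finite subset of $\Gamma$ is satisfiable in some model of $\mathfrak C_{tree}$, but $\Gamma$ is not satisfiable in any model of $\mathfrak C_{tree}$ (i.e. the logic is not compact over $\mathfrak C_{tree}$).
   Context: Mono-modal setting: countable $\mathsf{Prop}$, a countably infinite set $\mathsf{Nom}$ of nominals disjoint from $\mathsf{Prop}$, one modal symbol $\mathsf a$ and one equality symbol. Path expressions $\alpha::=\mathsf a\mid @_i\mid[\varphi]\mid\alpha\beta$; node expressions $\varphi::=p\mid i\mid\neg\varphi\mid\varphi\wedge\psi\mid\langle\alpha=\beta\rangle\mid\langle\alpha\neq\beta\rangle$. Models $\mathcal M=\langle M,\sim,R_{\mathsf a},V,\mathit{nom}\rangle$ with $\sim$ an equivalence relation on $M\neq\emptyset$, $R_{\mathsf a}\subseteq M^2$, $V:M\to2^{\mathsf{Prop}}$, $\mathit{nom}:\mathsf{Nom}\to M$. Semantics: $m,n\models\mathsf a$ iff $mR_{\mathsf a}n$; $m,n\models@_i$ iff $\mathit{nom}(i)=n$; $m,n\models[\varphi]$ iff $m=n$ and $m\models\varphi$; $m,n\models\alpha\beta$ iff some $l$ with $m,l\models\alpha$, $l,n\models\beta$; $m\models p$ iff $p\in V(m)$; $m\models i$ iff $\mathit{nom}(i)=m$; Booleans usual; $m\models\langle\alpha=\beta\rangle$ (resp. $\neq$) iff there are $n,l$ with $m,n\models\alpha$, $m,l\models\beta$, $n\sim l$ (resp. not). A set $\Gamma$ is satisfiable in $\mathcal M$ if some point satisfies all its members. $\mathfrak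 C_{tree}$ is the class of such models where: there is a unique point with no $R_{\mathsf a}$-predecessor (the root); every point is reachable from the root in zero or more $R_{\mathsf a}$-steps; every point has at most one $R_{\mathsf a}$-predecessor; no point is reachable from itself in one or more $R_{\mathsf a}$-steps. -}

module Defs where

open import Data.Nat using (ℕ)
open import Data.Bool using (Bool; true)
open import Data.Product using (Σ; ∃; _×_; _,_)
open import Data.List using (List)
open import Data.List.Relation.Unary.All using (All)
open import Data.List.Membership.Propositional using (_∈_)
open import Relation.Nullary using (¬_)
open import Relation.Binary.PropositionalEquality using (_≡_)
open import Relation.Binary.Structures using (IsEquivalence)
open import Relation.Binary.Construct.Closure.ReflexiveTransitive using (Star)
open import Relation.Binary.Construct.Closure.Transitive using (TransClosure)

-- Proposition symbols and nominals: both countably infinite sets, indexed by ℕ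
-- (they live in distinct syntactic categories, hence are disjoint).
Prp : Set
Prp = ℕ

Nom : Set
Nom = ℕ

mutual
  data Path : Set where
    `a    : Path
    at    : Nom → Path
    test  : Node → Path
    _∙_   : Path → Path → Path

  data Node : Set where
    prop  : Prp → Node
    nom   : Nom → Node
    ¬'_   : Node → Node
    _∧'_  : Node → Node → Node
    ⟨_≐_⟩ : Path → Path → Node
    ⟨_≠_⟩ : Path → Path → Node

record Model : Set₁ where
  field
    M      : Set
    point  : M                      -- M ≠ ∅
    _∼_    : M → M → Set
    ∼-equiv : IsEquivalence _∼_
    R      : M → M → Set
    V      : M → Prp → Bool
    nomᴹ   : Nom → M

module _ (𝓜 : Model) where
  open Model 𝓜

  mutual
    _,_⊨ₚ_ : M → M → Path → Set
    m , n ⊨ₚ `a      = R m n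
    m , n ⊨ₚ at i    = nomᴹ i ≡ n
    m , n ⊨ₚ test φ  = (m ≡ n) × (m ⊨ φ)
    m , n ⊨ₚ (α ∙ β) = ∃ λ l → (m , l ⊨ₚ α) × (l , n ⊨ₚ β)

    _⊨_ : M → Node → Set
    m ⊨ prop p  = V m p ≡ true
    m ⊨ nom i   = nomᴹ i ≡ m
    m ⊨ (¬' φ)  = ¬ (m ⊨ φ)
    m ⊨ (φ ∧' ψ) = (m ⊨ φ) × (m ⊨ ψ)
    m ⊨ ⟨ α ≐ β ⟩ = ∃ λ n → ∃ λ l → (m , n ⊨ₚ α) × (m , l ⊨ₚ β) × (n ∼ l)
    m ⊨ ⟨ α ≠ β ⟩ = ∃ λ n → ∃ λ l → (m , n ⊨ₚ α) × (m , l ⊨ₚ β) × ¬ (n ∼ l)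

  SatisfiableIn : (Node → Set) → Set
  SatisfiableIn Γ = ∃ λ m → ∀ φ → Γ φ → m ⊨ φ

IsTree : Model → Set
IsTree 𝓜 =
    (∃ λ r → (¬ (∃ λ x → R x r)) × (∀ y → ¬ (∃ λ x → R x y) → y ≡ r)
           × (∀ y → Star R r y))
  × (∀ x y z → R y x → R z x → y ≡ z)
  × (∀ x → ¬ TransClosure R x x)
  where open Model 𝓜

SatisfiableInTree : (Node → Set) → Set₁
SatisfiableInTree Γ = ∃ λ (𝓜 : Model) → IsTree 𝓜 × SatisfiableIn 𝓜 Γ

ListSet : List Node → Node → Set
ListSet Δ φ = φ ∈ Δ

-- Γ = { ⟨@ᵢ₊₁ a [i] = @ᵢ₊₁ a [i]⟩ | i ∈ ℕ } says that each nominal i + 1 names an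
-- a-predecessor of nominal i.  In a tree predecessors are unique, so walking back from
-- the root to nominal 0 along this chain shows the root itself is named by a nominal and
-- hence has a predecessor.  A finite part of Γ only mentions nominals below some N and
-- holds on the line 0 → 1 → 2 → … with nominal i naming N ∸ i.
module Submission where

open import Defs
open import Data.Product using (∃; _×_; _,_)
open import Data.List using (List)
open import Data.List.Relation.Unary.All as All using (All; []; _∷_)
open import Relation.Nullary using (¬_)

open import Data.Nat using (ℕ; zero; suc; _∸_; _<_; _⊔_)
open import Data.Nat.Properties using (<-trans; <-irrefl; n<1+n; m≤m⊔n; m≤n⊔m; <-≤-trans; +-∸-assoc)
open import Data.Bool using (true)
open import Data.Empty using (⊥-elim)
open import Level using (0ℓ)
open import Relation.Binary using (Rel)
open import Relation.Binary.PropositionalEquality using (_≡_; refl; sym; isEquivalence)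
open import Relation.Binary.Structures using (IsEquivalence)
open import Relation.Binary.Construct.Closure.ReflexiveTransitive using (Star; ε; _◅_; _◅◅_)
open import Relation.Binary.Construct.Closure.Transitive using (TransClosure; [_]; _∷_)

AtMostOnePredecessor : {A : Set} → Rel A 0ℓ → Set
AtMostOnePredecessor {A} R = ∀ {x y z : A} → R y x → R z x → y ≡ z

module _ {A : Set} {R : Rel A 0ℓ} (unique : AtMostOnePredecessor R)
         (c : ℕ → A) (descending : ∀ k → R (c (suc k)) (c k)) where

  reaches-chain⇒on-chain : ∀ {x k} → Star R x (c k) → ∃ λ j → x ≡ c j
  reaches-chain⇒on-chain {k = k} ε = k , refl
  reaches-chain⇒on-chain (xRy ◅ y⇝c) with reaches-chain⇒on-chain y⇝c
  ... | j , refl = suc j , unique xRy (descending j)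

  reaches-chain⇒has-predecessor : ∀ {x k} → Star R x (c k) → ∃ λ w → R w x
  reaches-chain⇒has-predecessor x⇝c with reaches-chain⇒on-chain x⇝c
  ... | j , refl = c (suc j) , descending j

linked : Nom → Node
linked i = ⟨ chainStep ≐ chainStep ⟩
  where chainStep = at (suc i) ∙ (`a ∙ test (nom i))

module _ (𝓜 : Model) where
  open Model 𝓜

  ⊨linked⇒R : ∀ m i → _⊨_ 𝓜 m (linked i) → R (nomᴹ (suc i)) (nomᴹ i)
  ⊨linked⇒R _ i (_ , _ , (_ , refl , _ , r , refl , refl) , _) = r

  R⇒⊨linked : ∀ m i → R (nomᴹ (suc i)) (nomᴹ i) → _⊨_ 𝓜 m (linked i)
  R⇒⊨linked _ i r = _ , _ , step , step , IsEquivalence.refl ∼-equiv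
    where step = _ , refl , _ , r , refl , refl

Γ : Node → Set
Γ ψ = ∃ λ i → ψ ≡ linked i

Γ-unsatisfiable : ¬ SatisfiableInTree Γ
Γ-unsatisfiable (𝓜 , ((_ , noPredecessor , _ , reachable) , unique , _) , m , m⊨Γ) =
  noPredecessor (reaches-chain⇒has-predecessor (unique _ _ _) nomᴹ descending (reachable (nomᴹ 0)))
  where
  open Model 𝓜
  descending : ∀ i → R (nomᴹ (suc i)) (nomᴹ i)
  descending i = ⊨linked⇒R 𝓜 m i (m⊨Γ (linked i) (i , refl))

Successor : Rel ℕ 0ℓ
Successor x y = suc x ≡ y

line : ℕ → Model
line N = record
  { M = ℕ ; point = 0 ; _∼_ = _≡_ ; ∼-equiv = isEquivalence
  ; R = Successor ; V = λ _ _ → true ; nomᴹ = N ∸_ }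

0⇝ : ∀ y → Star Successor 0 y
0⇝ zero    = ε
0⇝ (suc y) = 0⇝ y ◅◅ (refl ◅ ε)

Successor⁺⇒< : ∀ {x y} → TransClosure Successor x y → x < y
Successor⁺⇒< [ refl ]      = n<1+n _
Successor⁺⇒< (refl ∷ x⁺y) = <-trans (n<1+n _) (Successor⁺⇒< x⁺y)

line-isTree : ∀ N → IsTree (line N)
line-isTree N =
    (0 , (λ ()) , onlyRoot , 0⇝)
  , (λ { _ _ _ refl refl → refl })
  , (λ x x⁺x → <-irrefl refl (Successor⁺⇒< x⁺x))
  where
  onlyRoot : ∀ y → ¬ ∃ (λ x → Successor x y) → y ≡ 0
  onlyRoot zero    _             = refl
  onlyRoot (suc y) noPredecessor = ⊥-elim (noPredecessor (y , refl))

line⊨linked : ∀ {N} m i → i < N → _⊨_ (line N) m (linked i)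
-- suc N ∸ suc i, the left side of +-∸-assoc, reduces to N ∸ i.
line⊨linked {N} m i i<N = R⇒⊨linked (line N) m i (sym (+-∸-assoc 1 i<N))

BoundedBy : ℕ → Node → Set
BoundedBy N ψ = ∃ λ i → i < N × ψ ≡ linked i

finite-Γ-bounded : ∀ {Δ} → All Γ Δ → ∃ λ N → All (BoundedBy N) Δ
finite-Γ-bounded []               = 0 , []
finite-Γ-bounded ((i , ψ≡) ∷ Δ⊆Γ) with finite-Γ-bounded Δ⊆Γ
... | N , bounded =
    suc i ⊔ N
  , (i , m≤m⊔n (suc i) N , ψ≡)
  ∷ All.map (λ { (j , j<N , ψ≡) → j , <-≤-trans j<N (m≤n⊔m (suc i) N) , ψ≡ }) bounded

Γ-finitelySatisfiable : (Δ : List Node) → All Γ Δ → SatisfiableInTree (ListSet Δ)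
Γ-finitelySatisfiable Δ Δ⊆Γ with finite-Γ-bounded Δ⊆Γ
... | N , bounded = line N , line-isTree N , 0 , λ ψ ψ∈Δ → ⊨bounded (All.lookup bounded ψ∈Δ)
  where
  ⊨bounded : ∀ {ψ} → BoundedBy N ψ → _⊨_ (line N) 0 ψ
  ⊨bounded (i , i<N , refl) = line⊨linked 0 i i<N

proposition4p2 : ∃ λ (Γ : Node → Set) →
    ((Δ : List Node) → All Γ Δ → SatisfiableInTree (ListSet Δ))
    × ¬ SatisfiableInTree Γ
proposition4p2 = Γ , Γ-finitelySatisfiable , Γ-unsatisfiable
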